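{- Let $f \in \mathbb{N}_0[x^{\pm 1}]$ be such that $f(1) = p + q$ for some prime numbers $p$ and $q$. Then $f$ can be written as the sum of two irreducible elements of $\mathbb{N}_0[x^{\pm 1}]$.
   Context: $\mathbb{N}_0[x^{\pm 1}]$ denotes the commutative semiring of Laurent polynomials in $x$ with nonnegative integer coefficients. Its units are exactly the monomials $x^k$, $k \in \mathbb{Z}$. An element is irreducible if it is nonzero, not a unit, and cannot be written as a product of two non-units. $f(1)$ denotes the sum of the coefficients of $f$. -}

module Defs where

open import Data.Nat as ℕ using (ℕ; zero; suc)
open import Data.Integer as ℤ using (ℤ; +_; -[1+_])
open import Data.List using (List; []; _∷_; map; replicate; _++_)
open import Data.Nat.ListAction using (sum)
open import Data.Product using (Σ; ∃; _×_; _,_)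
open import Data.Sum using (_⊎_)
open import Relation.Binary.PropositionalEquality using (_≡_)
open import Relation.Nullary using (¬_)

-- Polynomials in ℕ₀[x]: coefficient lists, constant term first.
Poly : Set
Poly = List ℕ

_+ₚ_ : Poly → Poly → Poly
[] +ₚ q = q
(a ∷ p) +ₚ [] = a ∷ p
(a ∷ p) +ₚ (b ∷ q) = (a ℕ.+ b) ∷ (p +ₚ q)

_*ₚ_ : Poly → Poly → Poly
[] *ₚ q = []
(a ∷ p) *ₚ q = map (a ℕ.*_) q +ₚ (0 ∷ (p *ₚ q))

coeffₚ : Poly → ℕ → ℕ
coeffₚ [] n = 0
coeffₚ (a ∷ p) zero = a
coeffₚ (a ∷ p) (suc n) = coeffₚ p n

-- A Laurent polynomial x^shift · poly with poly ∈ ℕ₀[x].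
record Laurent : Set where
  constructor laurent
  field
    poly  : Poly
    shift : ℤ
open Laurent public

coeffℤ : Poly → ℤ → ℕ
coeffℤ P (+ m) = coeffₚ P m
coeffℤ P -[1+ _ ] = 0

coeff : Laurent → ℤ → ℕ
coeff f n = coeffℤ (poly f) (n ℤ.- shift f)

infix 4 _≈_
_≈_ : Laurent → Laurent → Set
f ≈ g = ∀ n → coeff f n ≡ coeff g n

0L : Laurent
0L = laurent [] (+ 0)

1L : Laurent
1L = laurent (1 ∷ []) (+ 0)

infixl 7 _*L_
_*L_ : Laurent → Laurent → Laurent
laurent P k *L laurent Q l = laurent (P *ₚ Q) (k ℤ.+ l)

infixl 6 _+L_
_+L_ : Laurent → Laurent → Laurent
laurent P k +L laurent Q l =
  laurent (pad (k ℤ.- m) P +ₚ pad (l ℤ.- m) Q) m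
  where
  m = k ℤ.⊓ l
  pad : ℤ → Poly → Poly
  pad d R = replicate ℤ.∣ d ∣ 0 ++ R

eval1 : Laurent → ℕ
eval1 f = sum (poly f)

IsUnit : Laurent → Set
IsUnit f = Σ Laurent λ g → f *L g ≈ 1L

Irreducible : Laurent → Set
Irreducible f =
  (¬ f ≈ 0L) × (¬ IsUnit f) ×
  (∀ g h → f ≈ g *L h → IsUnit g ⊎ IsUnit h)

{-# OPTIONS --safe #-}
-- The augmentation f ↦ f(1) is a semiring homomorphism ℕ₀[x^{±1}] → ℕ that
-- respects ≈, and it sends exactly the monomials to 1. Hence an element whose
-- value at 1 is prime is irreducible. Given f(1) = p + q, split every
-- coefficient of f in two, greedily assigning mass p to the first summand.
module Submission where

open import Defs
open import Data.Nat using (ℕ; _+_)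
open import Data.Nat.Primality using (Prime)
open import Data.Product using (Σ; _×_)
open import Relation.Binary.PropositionalEquality using (_≡_)

open import Data.Nat using (zero; suc; _*_; _∸_; _⊓_; _≤_; _≤?_; z≤n; s≤s; nonTrivial⇒≢1; ≢-nonZero⁻¹)
import Data.Nat.Properties as ℕ
open import Algebra.Properties.CommutativeSemigroup ℕ.+-commutativeSemigroup using (interchange)
open import Data.Nat.Divisibility using (divides)
open import Data.Nat.Primality using (prime⇒irreducible; prime⇒nonZero; prime⇒nonTrivial)
open import Data.Integer as ℤ using (ℤ; +_; -[1+_]; 0ℤ)
import Data.Integer.Properties as ℤ
open import Data.Integer.Tactic.RingSolver using (solve-∀)
open import Data.List using ([]; _∷_; map; replicate; _++_; length)
open import Data.Nat.ListAction using (sum)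
open import Data.Product using (_,_)
open import Data.Sum as ⊎ using (_⊎_; inj₁; inj₂)
open import Data.Empty using (⊥-elim)
open import Relation.Nullary using (¬_; yes; no)
open import Relation.Binary.PropositionalEquality using (refl; sym; trans; cong; cong₂; subst; _≢_; module ≡-Reasoning)

open ≡-Reasoning

sum-+ₚ : ∀ P Q → sum (P +ₚ Q) ≡ sum P + sum Q
sum-+ₚ [] Q = refl
sum-+ₚ (a ∷ P) [] = sym (ℕ.+-identityʳ _)
sum-+ₚ (a ∷ P) (b ∷ Q) = trans (cong (_+_ (a + b)) (sum-+ₚ P Q)) (interchange a b (sum P) (sum Q))

sum-map-* : ∀ a Q → sum (map (a *_) Q) ≡ a * sum Q
sum-map-* a [] = sym (ℕ.*-zeroʳ a)
sum-map-* a (b ∷ Q) = trans (cong (_+_ (a * b)) (sum-map-* a Q)) (sym (ℕ.*-distribˡ-+ a b (sum Q)))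

sum-*ₚ : ∀ P Q → sum (P *ₚ Q) ≡ sum P * sum Q
sum-*ₚ [] Q = refl
sum-*ₚ (a ∷ P) Q = begin
  sum (map (a *_) Q +ₚ (0 ∷ P *ₚ Q))  ≡⟨ sum-+ₚ (map (a *_) Q) (0 ∷ P *ₚ Q) ⟩
  sum (map (a *_) Q) + sum (P *ₚ Q)   ≡⟨ cong₂ _+_ (sum-map-* a Q) (sum-*ₚ P Q) ⟩
  a * sum Q + sum P * sum Q                     ≡⟨ sym (ℕ.*-distribʳ-+ (sum Q) a (sum P)) ⟩
  (a + sum P) * sum Q                           ∎

eval1-*L : ∀ f g → eval1 (f *L g) ≡ eval1 f * eval1 g
eval1-*L (laurent P k) (laurent Q l) = sum-*ₚ P Q

windowSum : (ℤ → ℕ) → ℤ → ℕ → ℕ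
windowSum c z zero = 0
windowSum c z (suc N) = c z + windowSum c (ℤ.suc z) N

windowSum-cong : ∀ {c d} → (∀ n → c n ≡ d n) → ∀ z N → windowSum c z N ≡ windowSum d z N
windowSum-cong c≗d z zero = refl
windowSum-cong c≗d z (suc N) = cong₂ _+_ (c≗d z) (windowSum-cong c≗d (ℤ.suc z) N)

windowSum-translate : ∀ c k z N → windowSum (λ n → c (n ℤ.- k)) z N ≡ windowSum c (z ℤ.- k) N
windowSum-translate c k z zero = refl
windowSum-translate c k z (suc N) = cong (_+_ (c (z ℤ.- k))) (begin
  windowSum (λ n → c (n ℤ.- k)) (ℤ.suc z) N  ≡⟨ windowSum-translate c k (ℤ.suc z) N ⟩
  windowSum c (ℤ.suc z ℤ.- k) N              ≡⟨ cong (λ w → windowSum c w N) (ℤ.+-assoc (+ 1) z (ℤ.- k)) ⟩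
  windowSum c (ℤ.suc (z ℤ.- k)) N            ∎)

coeffℤ-[] : ∀ z → coeffℤ [] z ≡ 0
coeffℤ-[] (+ _) = refl
coeffℤ-[] -[1+ _ ] = refl

windowSum-coeffℤ-[] : ∀ z N → windowSum (coeffℤ []) z N ≡ 0
windowSum-coeffℤ-[] z zero = refl
windowSum-coeffℤ-[] z (suc N) = cong₂ _+_ (coeffℤ-[] z) (windowSum-coeffℤ-[] (ℤ.suc z) N)

windowSum-coeffℤ-∷ : ∀ a P m N → windowSum (coeffℤ (a ∷ P)) (+ suc m) N ≡ windowSum (coeffℤ P) (+ m) N
windowSum-coeffℤ-∷ a P m zero = refl
windowSum-coeffℤ-∷ a P m (suc N) = cong (_+_ (coeffₚ P m)) (windowSum-coeffℤ-∷ a P (suc m) N)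

windowSum-coeffℤ-from-0 : ∀ P N → length P ≤ N → windowSum (coeffℤ P) (+ 0) N ≡ sum P
windowSum-coeffℤ-from-0 [] N _ = windowSum-coeffℤ-[] (+ 0) N
windowSum-coeffℤ-from-0 (a ∷ P) (suc N) (s≤s |P|≤N) =
  cong (_+_ a) (trans (windowSum-coeffℤ-∷ a P 0 N) (windowSum-coeffℤ-from-0 P N |P|≤N))

windowSum-coeffℤ : ∀ P z N → z ℤ.≤ 0ℤ → ℤ.∣ z ∣ + length P ≤ N → windowSum (coeffℤ P) z N ≡ sum P
windowSum-coeffℤ P (+ zero) N _ le = windowSum-coeffℤ-from-0 P N le
windowSum-coeffℤ P (+ suc n) N (ℤ.+≤+ ()) le
windowSum-coeffℤ P -[1+ zero ] (suc N) _ (s≤s le) = windowSum-coeffℤ-from-0 P N le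
windowSum-coeffℤ P -[1+ suc n ] (suc N) _ (s≤s le) = windowSum-coeffℤ P -[1+ n ] N ℤ.-≤+ le

windowSum-coeff : ∀ f a N → a ℤ.≤ shift f → ℤ.∣ a ℤ.- shift f ∣ + length (poly f) ≤ N →
                  windowSum (coeff f) a N ≡ eval1 f
windowSum-coeff (laurent P k) a N a≤k le =
  trans (windowSum-translate (coeffℤ P) k a N) (windowSum-coeffℤ P (a ℤ.- k) N (ℤ.i≤j⇒i-j≤0 a≤k) le)

-- Both supports lie in the window starting at min(shift f, shift g) of length A + B.
≈⇒eval1≡ : ∀ f g → f ≈ g → eval1 f ≡ eval1 g
≈⇒eval1≡ f g f≈g = begin
  eval1 f                 ≡⟨ sym (windowSum-coeff f a N (ℤ.i⊓j≤i (shift f) (shift g)) (ℕ.m≤m+n A B)) ⟩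
  windowSum (coeff f) a N ≡⟨ windowSum-cong f≈g a N ⟩
  windowSum (coeff g) a N ≡⟨ windowSum-coeff g a N (ℤ.i⊓j≤j (shift f) (shift g)) (ℕ.m≤n+m B A) ⟩
  eval1 g                 ∎
  where
  a = shift f ℤ.⊓ shift g
  A = ℤ.∣ a ℤ.- shift f ∣ + length (poly f)
  B = ℤ.∣ a ℤ.- shift g ∣ + length (poly g)
  N = A + B

≈-*L⇒eval1≡ : ∀ f g h → f ≈ g *L h → eval1 f ≡ eval1 g * eval1 h
≈-*L⇒eval1≡ f g h f≈gh = trans (≈⇒eval1≡ f (g *L h) f≈gh) (eval1-*L g h)

monomial : ℕ → Poly
monomial m = replicate m 0 ++ (1 ∷ [])

infix 4 _≗ₚ_
_≗ₚ_ : Poly → Poly → Set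
P ≗ₚ Q = ∀ i → coeffₚ P i ≡ coeffₚ Q i

sum≡0⇒≗ₚ[] : ∀ P → sum P ≡ 0 → P ≗ₚ []
sum≡0⇒≗ₚ[] [] _ i = refl
sum≡0⇒≗ₚ[] (a ∷ P) e zero = ℕ.m+n≡0⇒m≡0 a e
sum≡0⇒≗ₚ[] (a ∷ P) e (suc i) = sum≡0⇒≗ₚ[] P (ℕ.m+n≡0⇒n≡0 a e) i

sum≡1⇒≗ₚmonomial : ∀ P → sum P ≡ 1 → Σ ℕ λ m → P ≗ₚ monomial m
sum≡1⇒≗ₚmonomial (zero ∷ P) e with sum≡1⇒≗ₚmonomial P e
... | m , P≗xᵐ = suc m , λ { zero → refl ; (suc i) → P≗xᵐ i }
sum≡1⇒≗ₚmonomial (suc zero ∷ P) e = 0 , λ { zero → refl ; (suc i) → sum≡0⇒≗ₚ[] P (ℕ.suc-injective e) i }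
sum≡1⇒≗ₚmonomial (suc (suc a) ∷ P) e with () ← ℕ.suc-injective e

coeffₚ-monomial-≢ : ∀ m t → t ≢ m → coeffₚ (monomial m) t ≡ 0
coeffₚ-monomial-≢ zero zero t≢m = ⊥-elim (t≢m refl)
coeffₚ-monomial-≢ zero (suc t) _ = refl
coeffₚ-monomial-≢ (suc m) zero _ = refl
coeffₚ-monomial-≢ (suc m) (suc t) t≢m = coeffₚ-monomial-≢ m t (λ e → t≢m (cong suc e))

coeffₚ-monomial-≡ : ∀ m → coeffₚ (monomial m) m ≡ 1
coeffₚ-monomial-≡ zero = refl
coeffₚ-monomial-≡ (suc m) = coeffₚ-monomial-≡ m

coeffℤ-monomial-≢ : ∀ m w → w ≢ + m → coeffℤ (monomial m) w ≡ 0
coeffℤ-monomial-≢ m (+ t) w≢m = coeffₚ-monomial-≢ m t (λ e → w≢m (cong +_ e))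
coeffℤ-monomial-≢ m -[1+ _ ] _ = refl

coeffℤ-monomial : ∀ m w → coeffℤ (monomial m) w ≡ coeffℤ (monomial 0) (w ℤ.- + m)
coeffℤ-monomial m w with w ℤ.≟ + m
... | yes refl = trans (coeffₚ-monomial-≡ m) (cong (coeffℤ (monomial 0)) (sym (ℤ.+-inverseʳ (+ m))))
... | no w≢m = trans (coeffℤ-monomial-≢ m w w≢m) (sym (coeffℤ-monomial-≢ 0 (w ℤ.- + m) w-m≢0))
  where
  w-m≢0 : w ℤ.- + m ≢ 0ℤ
  w-m≢0 e = w≢m (ℤ.i-j≡0⇒i≡j w (+ m) e)

coeffℤ-cong : ∀ {P Q} → P ≗ₚ Q → ∀ z → coeffℤ P z ≡ coeffℤ Q z
coeffℤ-cong P≗Q (+ i) = P≗Q i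
coeffℤ-cong P≗Q -[1+ _ ] = refl

*ₚ-identityʳ : ∀ P → P *ₚ (1 ∷ []) ≗ₚ P
*ₚ-identityʳ [] i = refl
*ₚ-identityʳ (a ∷ P) zero = trans (ℕ.+-identityʳ _) (ℕ.*-identityʳ a)
*ₚ-identityʳ (a ∷ P) (suc i) = *ₚ-identityʳ P i

-- If poly f is x^m then f = x^(k+m), with inverse x^-(k+m).
eval1≡1⇒IsUnit : ∀ f → eval1 f ≡ 1 → IsUnit f
eval1≡1⇒IsUnit (laurent P k) e with sum≡1⇒≗ₚmonomial P e
... | m , P≗xᵐ = laurent (1 ∷ []) (ℤ.- (k ℤ.+ + m)) , λ n → let w = n ℤ.- (k ℤ.+ ℤ.- (k ℤ.+ + m)) in begin
  coeffℤ (P *ₚ (1 ∷ [])) w        ≡⟨ coeffℤ-cong (*ₚ-identityʳ P) w ⟩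
  coeffℤ P w                      ≡⟨ coeffℤ-cong P≗xᵐ w ⟩
  coeffℤ (monomial m) w           ≡⟨ coeffℤ-monomial m w ⟩
  coeffℤ (monomial 0) (w ℤ.- + m) ≡⟨ cong (coeffℤ (monomial 0)) (exponent n k (+ m)) ⟩
  coeffℤ (monomial 0) (n ℤ.- 0ℤ)  ∎
  where
  exponent : ∀ n k m → n ℤ.- (k ℤ.+ ℤ.- (k ℤ.+ m)) ℤ.- m ≡ n ℤ.- 0ℤ
  exponent = solve-∀

prime-*⇒≡1 : ∀ m n → Prime (m * n) → m ≡ 1 ⊎ n ≡ 1
prime-*⇒≡1 m n pr with prime⇒irreducible pr (divides n (ℕ.*-comm m n))
... | inj₁ m≡1 = inj₁ m≡1
... | inj₂ m≡mn = inj₂ (ℕ.*-cancelˡ-≡ n 1 m {{ℕ.m*n≢0⇒m≢0 m {{prime⇒nonZero pr}}}}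
                         (sym (trans (ℕ.*-identityʳ m) m≡mn)))

eval1-prime⇒Irreducible : ∀ f → Prime (eval1 f) → Irreducible f
eval1-prime⇒Irreducible f pr = nonzero , nonunit , factor
  where
  nonzero : ¬ f ≈ 0L
  nonzero f≈0 = ≢-nonZero⁻¹ (eval1 f) {{prime⇒nonZero pr}} (≈⇒eval1≡ f 0L f≈0)
  nonunit : ¬ IsUnit f
  nonunit (g , fg≈1) = nonTrivial⇒≢1 {{prime⇒nonTrivial pr}}
    (ℕ.m*n≡1⇒m≡1 (eval1 f) (eval1 g) (sym (≈-*L⇒eval1≡ 1L f g (λ n → sym (fg≈1 n)))))
  factor : ∀ g h → f ≈ g *L h → IsUnit g ⊎ IsUnit h
  factor g h f≈gh = ⊎.map (eval1≡1⇒IsUnit g) (eval1≡1⇒IsUnit h)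
    (prime-*⇒≡1 (eval1 g) (eval1 h) (subst Prime (≈-*L⇒eval1≡ f g h f≈gh) pr))

takeMass : ℕ → Poly → Poly
takeMass n [] = []
takeMass n (a ∷ P) = n ⊓ a ∷ takeMass (n ∸ a) P

dropMass : ℕ → Poly → Poly
dropMass n [] = []
dropMass n (a ∷ P) = a ∸ n ∷ dropMass (n ∸ a) P

takeMass-+ₚ-dropMass : ∀ n P → takeMass n P +ₚ dropMass n P ≡ P
takeMass-+ₚ-dropMass n [] = refl
takeMass-+ₚ-dropMass n (a ∷ P) = cong₂ _∷_ (ℕ.m⊓n+n∸m≡n n a) (takeMass-+ₚ-dropMass (n ∸ a) P)

sum-takeMass : ∀ n P → n ≤ sum P → sum (takeMass n P) ≡ n
sum-takeMass n [] n≤0 = sym (ℕ.n≤0⇒n≡0 n≤0)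
sum-takeMass n (a ∷ P) n≤a+ΣP with n ≤? a
... | yes n≤a rewrite ℕ.m≤n⇒m⊓n≡m n≤a | ℕ.m≤n⇒m∸n≡0 n≤a =
  trans (cong (_+_ n) (sum-takeMass 0 P z≤n)) (ℕ.+-identityʳ n)
... | no n≰a rewrite ℕ.m≥n⇒m⊓n≡n (ℕ.≰⇒≥ n≰a) =
  trans (cong (_+_ a) (sum-takeMass (n ∸ a) P (ℕ.m≤n+o⇒m∸n≤o n a n≤a+ΣP))) (ℕ.m+[n∸m]≡n (ℕ.≰⇒≥ n≰a))

+L-sameShift : ∀ P Q k → laurent P k +L laurent Q k ≡ laurent (P +ₚ Q) k
+L-sameShift P Q k rewrite ℤ.⊓-idem k | ℤ.+-inverseʳ k = refl

eval1-split : ∀ f m n → eval1 f ≡ m + n →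
              Σ Laurent λ g → Σ Laurent λ h → eval1 g ≡ m × eval1 h ≡ n × f ≈ g +L h
eval1-split (laurent P k) m n ΣP≡m+n =
  laurent P₁ k , laurent P₂ k , ΣP₁≡m , ΣP₂≡n , λ i → cong (λ g → coeff g i) (sym P₁+P₂≡P)
  where
  P₁ = takeMass m P
  P₂ = dropMass m P
  P₁+P₂≡P : laurent P₁ k +L laurent P₂ k ≡ laurent P k
  P₁+P₂≡P = trans (+L-sameShift P₁ P₂ k) (cong (λ R → laurent R k) (takeMass-+ₚ-dropMass m P))
  ΣP₁≡m : sum P₁ ≡ m
  ΣP₁≡m = sum-takeMass m P (subst (m ≤_) (sym ΣP≡m+n) (ℕ.m≤m+n m n))
  ΣP₂≡n : sum P₂ ≡ n
  ΣP₂≡n = ℕ.+-cancelˡ-≡ m (sum P₂) n (begin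
    m + sum P₂       ≡⟨ cong (_+ sum P₂) (sym ΣP₁≡m) ⟩
    sum P₁ + sum P₂  ≡⟨ sym (sum-+ₚ P₁ P₂) ⟩
    sum (P₁ +ₚ P₂)   ≡⟨ cong sum (takeMass-+ₚ-dropMass m P) ⟩
    sum P            ≡⟨ ΣP≡m+n ⟩
    m + n            ∎)

corollary2p2 : (f : Laurent) (p q : ℕ) → Prime p → Prime q → eval1 f ≡ p + q →
    Σ Laurent λ g → Σ Laurent λ h → Irreducible g × Irreducible h × f ≈ g +L h
corollary2p2 f p q pp pq f1≡p+q with eval1-split f p q f1≡p+q
... | g , h , g1≡p , h1≡q , f≈g+h =
  g , h , eval1-prime⇒Irreducible g (subst Prime (sym g1≡p) pp) ,
          eval1-prime⇒Irreducible h (subst Prime (sym h1≡q) pq) , f≈g+h
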